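{- For every $(p,\sigma,\tau)\in\mathrm{OShPf}(n)$, the pair $\varphi_o(p,\sigma,\tau)=(\mathtt{sort}(p'),\overline{\sigma}')$ is a garage (in particular a sorted naive shifted parking function of size $n$); that is, $\varphi_o:\mathrm{OShPf}(n)\to\mathrm{Gar}(n)$ is well defined.
   Context: Parking functions: an $n$-tuple $p$ of positive integers whose $i$-th smallest entry is at most $i$ for each $i$; $\mathrm{Pf}(n)$ their set; $\mathtt{sort}(p)$ the weakly increasing rearrangement; $\alpha_k(p)=\#\{j:p_j=k\}$; $\lambda(p)$ the partition of nonzero $\alpha_k(p)$; odd partition: all parts odd. For $\sigma\in\{ -1,1\}^n$, $\overline{\sigma}_k=\prod_{i:p_i=k}\sigma_i$ if $\alpha_k(p)>0$, else $0$. Odd shifted parking function of size $n$: a triple $(p,\sigma,\tau)$ with $p\in\mathrm{Pf}(n)$ of odd shape, $\sigma\in\{ -1,1\}^n$, $\tau$ a non-crossing partial matching of the set of values of $p$ (pairs $(a,b)$, $a<b$, disjoint, no $(a,c),(b,d)\in\tau$ with $a<b<c<d$) such that (1) $(a,b)\in\tau\Rightarrow\overline{\sigma}_a=-\overline{\sigma}_b$; (2) $(a,c)\in\tau$, $a<b<c\Rightarrow b$ appears in $p$; (3) $(a,d),(b,c)\in\tau$, $a<b<c<d\Rightarrow\overline{\sigma}_a=\overline{\sigma}_b$. $\mathrm{OShPf}(n)$ is their set. Sorted naive shifted parking function of size $n$: $(q,\rho)$ with $q\in\mathrm{Pf}(n)$ weakly increasing and $\rho\in\{ -1,0,1\}^n$,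 $\rho_k=0$ iff $\alpha_k(q)=0$. With $\upsilon_i=0,1,2$ according as $\alpha_i(q)=0$, odd, or positive even, $(q,\rho)$ is a garage if for all $i<j$ with $\upsilon_i=\upsilon_j=2$ such that every prefix of $\upsilon_{i+1}\cdots\upsilon_{j-1}$ has at least as many $2$'s as $0$'s, $\rho_i=\rho_j$. $\mathrm{Gar}(n)$ is the set of garages. The map $\varphi_o$: given $(p,\sigma,\tau)$, define $p'$ by $p'_i=p_i$ if $p_i$ is unmatched in $\tau$ or is the left endpoint of a pair of $\tau$, and $p'_i=a$ if $p_i=b$ with $(a,b)\in\tau$. Let $\overline{\sigma}'_k=\overline{\sigma}_k$ if $k$ appears in $p'$ and $\overline{\sigma}'_k=0$ otherwise. Set $\varphi_o(p,\sigma,\tau)=(\mathtt{sort}(p'),\overline{\sigma}')$. -}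

module Defs where

open import Data.Nat using (ℕ; zero; suc; _+_; _*_; _∸_; _≤_; _<_)
open import Data.Nat.Properties using (_≟_; ≤-decTotalOrder; ≤-totalOrder)
open import Data.Integer as ℤ using (ℤ; 0ℤ; 1ℤ; -1ℤ)
open import Data.Fin using (Fin; toℕ)
open import Data.List using (List; []; _∷_; length; filter; map; lookup)
open import Data.List.Relation.Unary.All using (All)
open import Data.List.Relation.Unary.Unique.Propositional using (Unique)
open import Data.List.Relation.Unary.Sorted.TotalOrder using (Sorted)
open import Data.List.Membership.Propositional using (_∈_)
open import Data.Product using (Σ; ∃; _×_; _,_; proj₁; proj₂)
open import Data.Sum using (_⊎_)
open import Data.Bool using (Bool; true; false; if_then_else_)
open import Data.Maybe using (Maybe; just; nothing)
open import Relation.Binary.PropositionalEquality using (_≡_)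
open import Relation.Nullary using (¬_; yes; no)
open import Function.Bundles using (_⇔_)

import Data.List.Sort ≤-decTotalOrder as NatSort

sort : List ℕ → List ℕ
sort = NatSort.sort

α : ℕ → List ℕ → ℕ
α k p = length (filter (k ≟_) p)

Appears : ℕ → List ℕ → Set
Appears k p = k ∈ p

IsPf : ℕ → List ℕ → Set
IsPf n p = length p ≡ n
         × All (1 ≤_) p
         × ((i : Fin (length (sort p))) → lookup (sort p) i ≤ suc (toℕ i))

Odd : ℕ → Set
Odd m = ∃ λ j → m ≡ suc (2 * j)

-- odd shape: every nonzero α_k(p) is odd (λ(p) has only odd parts)
OddShape : List ℕ → Set
OddShape p = ∀ k → α k p ≡ 0 ⊎ Odd (α k p)

IsSignVec : ℕ → List ℤ → Set
IsSignVec n σ = length σ ≡ n × All (λ s → s ≡ 1ℤ ⊎ s ≡ -1ℤ) σ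

prodAt : List ℕ → List ℤ → ℕ → ℤ
prodAt (x ∷ xs) (s ∷ ss) k with k ≟ x
... | yes _ = s ℤ.* prodAt xs ss k
... | no  _ = prodAt xs ss k
prodAt _ _ k = 1ℤ

σbar : List ℕ → List ℤ → ℕ → ℤ
σbar p σ k with α k p
... | zero  = 0ℤ
... | suc _ = prodAt p σ k

Matching : Set
Matching = List (ℕ × ℕ)

endpoints : Matching → List ℕ
endpoints [] = []
endpoints ((a , b) ∷ τ) = a ∷ b ∷ endpoints τ

IsNCMatching : List ℕ → Matching → Set
IsNCMatching p τ =
    (∀ {a b} → (a , b) ∈ τ → a < b × Appears a p × Appears b p)
  × Unique (endpoints τ)
  × (∀ {a b c d} → (a , c) ∈ τ → (b , d) ∈ τ → ¬ (a < b × b < c × c < d))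

IsOShPf : ℕ → List ℕ → List ℤ → Matching → Set
IsOShPf n p σ τ =
    IsPf n p
  × OddShape p
  × IsSignVec n σ
  × IsNCMatching p τ
  × (∀ {a b} → (a , b) ∈ τ → σbar p σ a ≡ ℤ.- σbar p σ b)
  × (∀ {a b c} → (a , c) ∈ τ → a < b → b < c → Appears b p)
  -- (3)
  × (∀ {a b c d} → (a , d) ∈ τ → (b , c) ∈ τ → a < b → b < c → c < d
       → σbar p σ a ≡ σbar p σ b)

-- Sorted naive shifted parking functions and garages
-- ρ ∈ {-1,0,1}^n is a function Fin n → ℤ; position i : Fin n is the
-- value k = toℕ i + 1.

val : {n : ℕ} → Fin n → ℕ
val i = suc (toℕ i)

IsSNShPf : (n : ℕ) → List ℕ → (Fin n → ℤ) → Set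
IsSNShPf n q ρ =
    IsPf n q
  × Sorted ≤-totalOrder q
  × (∀ i → ρ i ≡ -1ℤ ⊎ ρ i ≡ 0ℤ ⊎ ρ i ≡ 1ℤ)
  × (∀ i → ρ i ≡ 0ℤ ⇔ α (val i) q ≡ 0)

isEven : ℕ → Bool
isEven zero = true
isEven (suc m) with isEven m
... | true  = false
... | false = true

υ : List ℕ → ℕ → ℕ
υ q k with α k q
... | zero  = 0
... | suc m = if isEven (suc m) then 2 else 1

-- the values a+1, a+2, ..., b  (empty if b ≤ a)
interval : ℕ → ℕ → List ℕ
interval a b = go (suc a) (b ∸ a)
  where
  go : ℕ → ℕ → List ℕ
  go x zero = []
  go x (suc r) = x ∷ go (suc x) r

countυ : List ℕ → ℕ → ℕ → ℕ → ℕ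
countυ q t a b = length (filter (λ l → υ q l ≟ t) (interval a b))

IsGarage : (n : ℕ) → List ℕ → (Fin n → ℤ) → Set
IsGarage n q ρ =
    IsSNShPf n q ρ
  × (∀ (i j : Fin n) → toℕ i Data.Nat.< toℕ j
       → υ q (val i) ≡ 2 → υ q (val j) ≡ 2
       → (∀ m → val i ≤ m → m < val j → countυ q 0 (val i) m ≤ countυ q 2 (val i) m)
       → ρ i ≡ ρ j)

leftPartner : Matching → ℕ → Maybe ℕ
leftPartner [] b = nothing
leftPartner ((a , c) ∷ τ) b with b ≟ c
... | yes _ = just a
... | no  _ = leftPartner τ b

p′ : Matching → List ℕ → List ℕ
p′ τ p = map f p
  where
  f : ℕ → ℕ
  f x with leftPartner τ x
  ... | just a  = a
  ... | nothing = x

σbar′ : List ℕ → List ℤ → Matching → ℕ → ℤ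
σbar′ p σ τ k with α k (p′ τ p)
... | zero  = 0ℤ
... | suc _ = σbar p σ k

φo-q : List ℕ → List ℤ → Matching → List ℕ
φo-q p σ τ = sort (p′ τ p)

φo-ρ : (n : ℕ) → List ℕ → List ℤ → Matching → Fin n → ℤ
φo-ρ n p σ τ i = σbar′ p σ τ (val i)

{-# OPTIONS --safe #-}
module Submission where

-- Replacing the right endpoint b of each arc (a , b) by a only lowers entries, so p′ is again a
-- parking function. In p′ the value a occurs α_a + α_b times, an even number, b disappears, and
-- every other value keeps its odd or zero multiplicity; so υ_k = 2 only at left endpoints and
-- υ_b = 0 at right endpoints. Along (a , d] for an arc (a , d), each 2 starts an arc and arcs end
-- only at 0's, at most one at each; by non-crossing every arc starting in (a , d] also ends there,
-- and (a , d) itself ends at d. Hence υ_{a+1} ⋯ υ_d has more 0's than 2's. So if i < j both have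
-- υ = 2 and satisfy the prefix condition, the arc from i cannot end before j; by non-crossing the
-- arcs from i and j are nested, and condition (3) gives σ̄_i = σ̄_j.

open import Defs
open import Algebra.Properties.CommutativeSemigroup using (interchange)
open import Data.Bool using (true; false; not)
open import Data.Bool.Properties using (not-involutive)
open import Data.Empty using (⊥; ⊥-elim)
open import Data.Fin using (Fin; zero; suc; toℕ; cast)
open import Data.Fin.Properties using (toℕ-cast)
open import Data.Integer as ℤ using (ℤ; 0ℤ; 1ℤ; -1ℤ)
open import Data.List using (List; []; _∷_; [_]; _++_; length; filter; map; lookup)
open import Data.List.Membership.Propositional using (_∈_; _∉_; lose)
open import Data.List.Membership.Propositional.Properties using (∈-filter⁻; ∈-map⁻)
open import Data.List.Properties
  using (filter-++; length-++; length-map; filter-some; filter-none; filter-accept; filter-reject)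
open import Data.List.Relation.Binary.Permutation.Propositional using (_↭_; ↭-sym)
open import Data.List.Relation.Binary.Permutation.Propositional.Properties
  using (filter-↭; ↭-length; All-resp-↭)
open import Data.List.Relation.Unary.All as All using (All; _∷_)
import Data.List.Relation.Unary.All.Properties as All
open import Data.List.Relation.Unary.AllPairs using (_∷_)
open import Data.List.Relation.Unary.Any using (here; there)
import Data.List.Relation.Unary.Linked as Linked
open import Data.List.Relation.Unary.Sorted.TotalOrder.Properties using (lookup-mono-≤; Sorted⇒AllPairs)
open import Data.List.Relation.Unary.Unique.Propositional using (Unique)
open import Data.Maybe using (just; nothing)
open import Data.Nat
  using ( ℕ; zero; suc; _+_; _*_; _∸_; _≤_; _<_; z≤n; s≤s; s≤s⁻¹; _≤?_; _<?_
        ; _≤′_; ≤′-refl; ≤′-step )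
open import Data.Nat.Properties
open import Data.List.Relation.Unary.Sorted.TotalOrder ≤-totalOrder using (Sorted)
open import Data.List.Sort ≤-decTotalOrder using (sort-↭; sort-↗)
open import Data.Product using (∃; _×_; _,_; proj₁; proj₂)
open import Data.Sum using (_⊎_; inj₁; inj₂)
open import Function using (_∘_)
open import Function.Bundles using (_⇔_; mk⇔; Equivalence)
open import Level using (0ℓ)
open import Relation.Binary.Definitions using (tri<; tri≈; tri>)
open import Relation.Binary.PropositionalEquality hiding ([_])
open import Relation.Nullary using (Dec; yes; no; ¬_; contradiction; _×-dec_; _⊎-dec_)
open import Relation.Unary as U using (Pred)

indicator : {P : Set} → Dec P → ℕ
indicator (yes _) = 1
indicator (no _) = 0

count : {A : Set} {P : Pred A 0ℓ} → U.Decidable P → List A → ℕ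
count P? xs = length (filter P? xs)

module _ {A : Set} {P : Pred A 0ℓ} (P? : U.Decidable P) where

  count-[_] : ∀ x → count P? [ x ] ≡ indicator (P? x)
  count-[ x ] with P? x
  ... | yes _ = refl
  ... | no _ = refl

  count-accept : ∀ {x xs} → P x → count P? (x ∷ xs) ≡ suc (count P? xs)
  count-accept px = cong length (filter-accept P? px)

  count-reject : ∀ {x xs} → ¬ P x → count P? (x ∷ xs) ≡ count P? xs
  count-reject ¬px = cong length (filter-reject P? ¬px)

  count-++ : ∀ xs ys → count P? (xs ++ ys) ≡ count P? xs + count P? ys
  count-++ xs ys = trans (cong length (filter-++ P? xs ys)) (length-++ (filter P? xs))

  count-↭ : ∀ {xs ys} → xs ↭ ys → count P? xs ≡ count P? ys
  count-↭ xs↭ys = ↭-length (filter-↭ P? xs↭ys)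

  count-map : ∀ {B : Set} (f : B → A) xs → count P? (map f xs) ≡ count (P? ∘ f) xs
  count-map f [] = refl
  count-map f (x ∷ xs) with P? (f x)
  ... | yes _ = cong suc (count-map f xs)
  ... | no _ = count-map f xs

  ∈⇒count-pos : ∀ {x xs} → x ∈ xs → P x → 0 < count P? xs
  ∈⇒count-pos x∈xs px = filter-some P? (lose x∈xs px)

  count-pos⇒∈ : ∀ xs → 0 < count P? xs → ∃ λ x → x ∈ xs × P x
  count-pos⇒∈ xs pos with filter P? xs in eq
  ... | x ∷ _ = x , ∈-filter⁻ P? (subst (x ∈_) (sym eq) (here refl))

  count-≡0 : ∀ {xs} → (∀ {x} → x ∈ xs → ¬ P x) → count P? xs ≡ 0
  count-≡0 ¬P = cong length (filter-none P? (All.tabulate ¬P))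

module _ {A : Set} {P Q : Pred A 0ℓ} (P? : U.Decidable P) (Q? : U.Decidable Q) where

  count-mono-≤ : ∀ {xs} → (∀ {x} → x ∈ xs → P x → Q x) → count P? xs ≤ count Q? xs
  count-mono-≤ {[]} P⇒Q = z≤n
  count-mono-≤ {x ∷ xs} P⇒Q with P? x | Q? x
  ... | yes _  | yes _  = s≤s (count-mono-≤ (P⇒Q ∘ there))
  ... | yes px | no ¬qx = contradiction (P⇒Q (here refl) px) ¬qx
  ... | no _   | yes _  = m≤n⇒m≤1+n (count-mono-≤ (P⇒Q ∘ there))
  ... | no _   | no _   = count-mono-≤ (P⇒Q ∘ there)

  count-mono-< : ∀ {xs y} → (∀ {x} → x ∈ xs → P x → Q x) → y ∈ xs → ¬ P y → Q y
    → count P? xs < count Q? xs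
  count-mono-< {x ∷ xs} P⇒Q (here refl) ¬py qy with P? x | Q? x
  ... | yes px | _      = contradiction px ¬py
  ... | no _   | yes _  = s≤s (count-mono-≤ (P⇒Q ∘ there))
  ... | no _   | no ¬qy = contradiction qy ¬qy
  count-mono-< {x ∷ xs} P⇒Q (there y∈xs) ¬py qy with P? x | Q? x
  ... | yes _  | yes _  = s≤s (count-mono-< (P⇒Q ∘ there) y∈xs ¬py qy)
  ... | yes px | no ¬qx = contradiction (P⇒Q (here refl) px) ¬qx
  ... | no _   | yes _  = m<n⇒m<1+n (count-mono-< (P⇒Q ∘ there) y∈xs ¬py qy)
  ... | no _   | no _   = count-mono-< (P⇒Q ∘ there) y∈xs ¬py qy

  count-⊎ : ∀ xs → (∀ {x} → P x → ¬ Q x)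
    → count (λ x → P? x ⊎-dec Q? x) xs ≡ count P? xs + count Q? xs
  count-⊎ [] _ = refl
  count-⊎ (x ∷ xs) disjoint with P? x | Q? x
  ... | yes px | yes qx = contradiction qx (disjoint px)
  ... | yes _  | no _   = cong suc (count-⊎ xs disjoint)
  ... | no _   | yes _  = trans (cong suc (count-⊎ xs disjoint)) (sym (+-suc _ _))
  ... | no _   | no _   = count-⊎ xs disjoint

count-cong : {A : Set} {P Q : Pred A 0ℓ} (P? : U.Decidable P) (Q? : U.Decidable Q) {xs : List A}
  → (∀ {x} → x ∈ xs → P x ⇔ Q x) → count P? xs ≡ count Q? xs
count-cong P? Q? P⇔Q = ≤-antisym (count-mono-≤ P? Q? (Equivalence.to ∘ P⇔Q))
                                 (count-mono-≤ Q? P? (Equivalence.from ∘ P⇔Q))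

module _ {k : ℕ} where

  lookup≤⇒index<count : ∀ {s} → Sorted s → (i : Fin (length s))
    → lookup s i ≤ k → suc (toℕ i) ≤ count (_≤? k) s
  lookup≤⇒index<count {x ∷ s} _ zero x≤k =
    ≤-trans (s≤s z≤n) (≤-reflexive (sym (count-accept (_≤? k) x≤k)))
  lookup≤⇒index<count {x ∷ s} s↗ (suc i) sᵢ≤k = begin
    suc (suc (toℕ i))      ≤⟨ s≤s (lookup≤⇒index<count (Linked.tail s↗) i sᵢ≤k) ⟩
    suc (count (_≤? k) s)  ≡⟨ count-accept (_≤? k) (≤-trans x≤sᵢ sᵢ≤k) ⟨
    count (_≤? k) (x ∷ s)  ∎
    where
    open ≤-Reasoning
    x≤sᵢ = lookup-mono-≤ ≤-totalOrder s↗ {zero} {suc i} z≤n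

  index<count⇒lookup≤ : ∀ {s} → Sorted s → (i : Fin (length s))
    → suc (toℕ i) ≤ count (_≤? k) s → lookup s i ≤ k
  index<count⇒lookup≤ {x ∷ s} s↗ i i<count with x ≤? k | Sorted⇒AllPairs ≤-totalOrder s↗
  ... | yes x≤k | _ with i
  ...   | zero = x≤k
  ...   | suc i′ = index<count⇒lookup≤ (Linked.tail s↗) i′
                     (s≤s⁻¹ (≤-trans i<count (≤-reflexive (count-accept (_≤? k) x≤k))))
  index<count⇒lookup≤ {x ∷ s} s↗ i i<count | no x≰k | x≤s ∷ _ =
    contradiction (≤-trans i<count (≤-reflexive none)) λ ()
    where
    none : count (_≤? k) (x ∷ s) ≡ 0
    none = count-≡0 (_≤? k) {x ∷ s} λ where
      (here refl) → x≰k
      (there y∈s) y≤k → x≰k (≤-trans (All.lookup x≤s y∈s) y≤k)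

Parks : List ℕ → Set
Parks p = (i : Fin (length (sort p))) → lookup (sort p) i ≤ suc (toℕ i)

parks-mono : ∀ {xs ys} → length xs ≡ length ys → (∀ k → count (_≤? k) xs ≤ count (_≤? k) ys)
  → Parks xs → Parks ys
parks-mono {xs} {ys} len≡ more xs-parks i = index<count⇒lookup≤ (sort-↗ ys) i (begin
  suc (toℕ i)                        ≡⟨ cong suc (toℕ-cast len≡′ i) ⟨
  suc (toℕ i′)                       ≤⟨ subst (λ t → suc (toℕ i′) ≤ count (_≤? suc t) (sort xs))
                                              (toℕ-cast len≡′ i)
                                              (lookup≤⇒index<count (sort-↗ xs) i′ (xs-parks i′)) ⟩
  count (_≤? suc (toℕ i)) (sort xs)  ≡⟨ count-↭ (_≤? _) (sort-↭ xs) ⟩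
  count (_≤? suc (toℕ i)) xs         ≤⟨ more (suc (toℕ i)) ⟩
  count (_≤? suc (toℕ i)) ys         ≡⟨ count-↭ (_≤? _) (sort-↭ ys) ⟨
  count (_≤? suc (toℕ i)) (sort ys)  ∎)
  where
  open ≤-Reasoning
  len≡′ : length (sort ys) ≡ length (sort xs)
  len≡′ = trans (↭-length (sort-↭ ys)) (trans (sym len≡) (sym (↭-length (sort-↭ xs))))
  i′ : Fin (length (sort xs))
  i′ = cast len≡′ i

isPf-sort-map : ∀ {n p} (f : ℕ → ℕ) → IsPf n p
  → (∀ {x} → x ∈ p → 1 ≤ f x) → (∀ {x} → x ∈ p → f x ≤ x) → IsPf n (sort (map f p))
isPf-sort-map {n} {p} f (len , _ , parks) f-pos f-≤ =
  trans len-fp len , pos , parks-mono (sym len-fp) lowered parks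
  where
  len-fp : length (sort (map f p)) ≡ length p
  len-fp = trans (↭-length (sort-↭ (map f p))) (length-map f p)
  pos : All (1 ≤_) (sort (map f p))
  pos = All-resp-↭ (↭-sym (sort-↭ (map f p))) (All.map⁺ (All.tabulate f-pos))
  lowered : ∀ k → count (_≤? k) p ≤ count (_≤? k) (sort (map f p))
  lowered k = begin
    count (_≤? k) p                 ≤⟨ count-mono-≤ (_≤? k) ((_≤? k) ∘ f) (≤-trans ∘ f-≤) ⟩
    count ((_≤? k) ∘ f) p           ≡⟨ count-map (_≤? k) f p ⟨
    count (_≤? k) (map f p)         ≡⟨ count-↭ (_≤? k) (sort-↭ (map f p)) ⟨
    count (_≤? k) (sort (map f p))  ∎
    where open ≤-Reasoning

range : ℕ → ℕ → List ℕ
range x zero = []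
range x (suc r) = x ∷ range (suc x) r

range-∷ʳ : ∀ x r → range x (suc r) ≡ range x r ++ [ x + r ]
range-∷ʳ x zero = cong [_] (sym (+-identityʳ x))
range-∷ʳ x (suc r) = cong (x ∷_) (begin
  range (suc x) (suc r)               ≡⟨ range-∷ʳ (suc x) r ⟩
  range (suc x) r ++ [ suc x + r ]    ≡⟨ cong (λ y → range (suc x) r ++ [ y ]) (+-suc x r) ⟨
  range (suc x) r ++ [ x + suc r ]    ∎)
  where open ≡-Reasoning

-- `interval` is defined through a local helper that cannot be named, so its
-- equations are reached by abstracting over any function satisfying them.
range-unique : (go : ℕ → ℕ → List ℕ)
  → (∀ x → go x 0 ≡ []) → (∀ x r → go x (suc r) ≡ x ∷ go (suc x) r)
  → ∀ x r → go x r ≡ range x r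
range-unique go go-zero go-suc x zero = go-zero x
range-unique go go-zero go-suc x (suc r) =
  trans (go-suc x r) (cong (x ∷_) (range-unique go go-zero go-suc (suc x) r))

interval≡range : ∀ a b → interval a b ≡ range (suc a) (b ∸ a)
interval≡range a b with suc a | b ∸ a | range-unique _ (λ _ → refl) (λ _ _ → refl)
... | x | r | go≡range = go≡range x r

interval-empty : ∀ a → interval a a ≡ []
interval-empty a = trans (interval≡range a a) (cong (range (suc a)) (n∸n≡0 a))

interval-∷ʳ : ∀ {a m} → a ≤ m → interval a (suc m) ≡ interval a m ++ [ suc m ]
interval-∷ʳ {a} {m} a≤m = begin
  interval a (suc m)                            ≡⟨ interval≡range a (suc m) ⟩
  range (suc a) (suc m ∸ a)                     ≡⟨ cong (range (suc a)) (+-∸-assoc 1 a≤m) ⟩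
  range (suc a) (suc (m ∸ a))                   ≡⟨ range-∷ʳ (suc a) (m ∸ a) ⟩
  range (suc a) (m ∸ a) ++ [ suc a + (m ∸ a) ]  ≡⟨ cong₂ (λ xs y → xs ++ [ suc y ])
                                                         (sym (interval≡range a m)) (m+[n∸m]≡n a≤m) ⟩
  interval a m ++ [ suc m ]                     ∎
  where open ≡-Reasoning

labelCount : (ℕ → ℕ) → ℕ → ℕ → ℕ → ℕ
labelCount u t a m = count (λ l → u l ≟ t) (interval a m)

labelCount-empty : ∀ u t a → labelCount u t a a ≡ 0
labelCount-empty u t a = cong (count (λ l → u l ≟ t)) (interval-empty a)

labelCount-suc : ∀ u t {a m} → a ≤ m
  → labelCount u t a (suc m) ≡ labelCount u t a m + indicator (u (suc m) ≟ t)
labelCount-suc u t {a} {m} a≤m = begin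
  labelCount u t a (suc m)                        ≡⟨ cong (count u≟t) (interval-∷ʳ a≤m) ⟩
  count u≟t (interval a m ++ [ suc m ])           ≡⟨ count-++ u≟t (interval a m) [ suc m ] ⟩
  labelCount u t a m + count u≟t [ suc m ]        ≡⟨ cong (labelCount u t a m +_) (count-[_] u≟t (suc m)) ⟩
  labelCount u t a m + indicator (u (suc m) ≟ t)  ∎
  where
  open ≡-Reasoning
  u≟t = λ l → u l ≟ t

Within : ℕ → ℕ → Pred ℕ 0ℓ
Within a m x = a < x × x ≤ m

within? : ∀ a m → U.Decidable (Within a m)
within? a m x = a <? x ×-dec x ≤? m

Within-suc : ∀ {a m} → a ≤ m → ∀ x → Within a (suc m) x ⇔ (Within a m x ⊎ suc m ≡ x)
Within-suc {a} {m} a≤m x = mk⇔ to from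
  where
  to : Within a (suc m) x → Within a m x ⊎ suc m ≡ x
  to (a<x , x≤1+m) with m≤n⇒m<n∨m≡n x≤1+m
  ... | inj₁ x<1+m = inj₁ (a<x , s≤s⁻¹ x<1+m)
  ... | inj₂ x≡1+m = inj₂ (sym x≡1+m)
  from : Within a m x ⊎ suc m ≡ x → Within a (suc m) x
  from (inj₁ (a<x , x≤m)) = a<x , m≤n⇒m≤1+n x≤m
  from (inj₂ refl) = s≤s a≤m , ≤-refl

ends : ℕ × ℕ → List ℕ
ends (a , b) = a ∷ b ∷ []

∈-endpoints : ∀ {τ e x} → e ∈ τ → x ∈ ends e → x ∈ endpoints τ
∈-endpoints (here refl) (here refl) = here refl
∈-endpoints (here refl) (there (here refl)) = there (here refl)
∈-endpoints (there e∈τ) x∈e = there (there (∈-endpoints e∈τ x∈e))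

fresh-head : ∀ {e τ x} → Unique (endpoints (e ∷ τ)) → x ∈ ends e → x ∉ endpoints τ
fresh-head (a∉ ∷ _ ∷ _) (here refl) x∈E = All.lookup a∉ (there x∈E) refl
fresh-head (_ ∷ b∉ ∷ _) (there (here refl)) x∈E = All.lookup b∉ x∈E refl

arc-determined-by-endpoint : ∀ {τ e e′ x} → Unique (endpoints τ) → e ∈ τ → e′ ∈ τ
  → x ∈ ends e → x ∈ ends e′ → e ≡ e′
arc-determined-by-endpoint _ (here refl) (here refl) _ _ = refl
arc-determined-by-endpoint U (here refl) (there e′∈τ) x∈e x∈e′ =
  ⊥-elim (fresh-head U x∈e (∈-endpoints e′∈τ x∈e′))
arc-determined-by-endpoint U (there e∈τ) (here refl) x∈e x∈e′ =
  ⊥-elim (fresh-head U x∈e′ (∈-endpoints e∈τ x∈e))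
arc-determined-by-endpoint (_ ∷ _ ∷ U) (there e∈τ) (there e′∈τ) x∈e x∈e′ =
  arc-determined-by-endpoint U e∈τ e′∈τ x∈e x∈e′

rightsAt≤1 : ∀ {τ} → Unique (endpoints τ) → ∀ k → count ((k ≟_) ∘ proj₂) τ ≤ 1
rightsAt≤1 {[]} _ k = z≤n
rightsAt≤1 {(a , b) ∷ τ} U@(_ ∷ _ ∷ U′) k with k ≟ b
... | yes refl =
  ≤-reflexive (trans (count-accept ((k ≟_) ∘ proj₂) refl) (cong suc (count-≡0 ((k ≟_) ∘ proj₂) fresh)))
  where
  fresh : ∀ {e} → e ∈ τ → k ≢ proj₂ e
  fresh e∈τ refl = fresh-head U (there (here refl)) (∈-endpoints e∈τ (there (here refl)))
... | no k≢b = ≤-trans (≤-reflexive (count-reject ((k ≟_) ∘ proj₂) k≢b)) (rightsAt≤1 U′ k)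

leftPartner-just : ∀ τ {x a} → leftPartner τ x ≡ just a → (a , x) ∈ τ
leftPartner-just ((b , c) ∷ τ) {x} eq with x ≟ c
leftPartner-just ((b , c) ∷ τ) refl | yes refl = here refl
... | no _ = there (leftPartner-just τ eq)

leftPartner-nothing : ∀ τ {x a} → leftPartner τ x ≡ nothing → (a , x) ∉ τ
leftPartner-nothing ((b , c) ∷ τ) {x} eq a,x∈τ with x ≟ c | a,x∈τ
leftPartner-nothing ((b , c) ∷ τ) () _ | yes _ | _
... | no x≢c | here refl = x≢c refl
... | no _ | there a,x∈τ′ = leftPartner-nothing τ eq a,x∈τ′

leftEndpoint? : (τ : Matching) (k : ℕ) → Dec (∃ λ c → (k , c) ∈ τ)
leftEndpoint? [] k = no λ { (_ , ()) }
leftEndpoint? ((a , c) ∷ τ) k with k ≟ a | leftEndpoint? τ k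
... | yes refl | _ = yes (c , here refl)
... | no _ | yes (c′ , k,c′∈τ) = yes (c′ , there k,c′∈τ)
... | no k≢a | no ¬left = no λ where
  (_ , here refl) → k≢a refl
  (c′ , there k,c′∈τ) → ¬left (c′ , k,c′∈τ)

collapse : Matching → ℕ → ℕ
collapse τ x with leftPartner τ x
... | just a = a
... | nothing = x

p′≡map-collapse : ∀ τ xs → p′ τ xs ≡ map (collapse τ) xs
p′≡map-collapse τ [] = refl
p′≡map-collapse τ (x ∷ xs) with leftPartner τ x
... | just a = cong (a ∷_) (p′≡map-collapse τ xs)
... | nothing = cong (x ∷_) (p′≡map-collapse τ xs)

collapse-cases : ∀ τ x
  → (∃ λ a → (a , x) ∈ τ × collapse τ x ≡ a) ⊎ ((∀ {a} → (a , x) ∉ τ) × collapse τ x ≡ x)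
collapse-cases τ x with leftPartner τ x in eq
... | just a = inj₁ (a , leftPartner-just τ eq , refl)
... | nothing = inj₂ (leftPartner-nothing τ eq , refl)

module Arcs {τ : Matching}
  (increasing : ∀ {a b} → (a , b) ∈ τ → a < b)
  (unique : Unique (endpoints τ))
  where

  left≢right : ∀ {a b c} → (b , c) ∈ τ → (a , b) ∈ τ → ⊥
  left≢right b,c∈τ a,b∈τ
    with arc-determined-by-endpoint unique b,c∈τ a,b∈τ (here refl) (there (here refl))
  ... | refl = <-irrefl refl (increasing a,b∈τ)

  same-right⇒same-left : ∀ {a b d} → (a , d) ∈ τ → (b , d) ∈ τ → a ≡ b
  same-right⇒same-left a,d∈τ b,d∈τ =
    cong proj₁ (arc-determined-by-endpoint unique a,d∈τ b,d∈τ (there (here refl)) (there (here refl)))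

  collapse-≤ : ∀ x → collapse τ x ≤ x
  collapse-≤ x with collapse-cases τ x
  ... | inj₁ (a , a,x∈τ , refl) = <⇒≤ (increasing a,x∈τ)
  ... | inj₂ (_ , eq) = ≤-reflexive eq

  collapse-misses-right : ∀ {a k} → (a , k) ∈ τ → ∀ x → k ≢ collapse τ x
  collapse-misses-right a,k∈τ x k≡ with collapse-cases τ x
  ... | inj₁ (b , b,x∈τ , eq) =
    left≢right (subst (λ z → (z , x) ∈ τ) (sym (trans k≡ eq)) b,x∈τ) a,k∈τ
  ... | inj₂ (¬right , eq) = ¬right (subst (λ z → (_ , z) ∈ τ) (trans k≡ eq) a,k∈τ)

  collapse-fixes-unmatched : ∀ {k} → (∀ {c} → (k , c) ∉ τ) → (∀ {a} → (a , k) ∉ τ)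
    → ∀ x → k ≡ collapse τ x ⇔ k ≡ x
  collapse-fixes-unmatched {k} ¬left ¬right x = mk⇔ to from
    where
    to : k ≡ collapse τ x → k ≡ x
    to k≡ with collapse-cases τ x
    ... | inj₁ (b , b,x∈τ , eq) =
      ⊥-elim (¬left (subst (λ z → (z , x) ∈ τ) (sym (trans k≡ eq)) b,x∈τ))
    ... | inj₂ (_ , eq) = trans k≡ eq
    from : k ≡ x → k ≡ collapse τ x
    from refl with collapse-cases τ k
    ... | inj₁ (_ , a,k∈τ , _) = ⊥-elim (¬right a,k∈τ)
    ... | inj₂ (_ , eq) = sym eq

  α-collapse-right : ∀ {a k} → (a , k) ∈ τ → ∀ xs → α k (map (collapse τ) xs) ≡ 0
  α-collapse-right {k = k} a,k∈τ xs = trans (count-map (k ≟_) (collapse τ) xs)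
    (count-≡0 ((k ≟_) ∘ collapse τ) {xs} (λ _ → collapse-misses-right a,k∈τ _))

  α-collapse-unmatched : ∀ {k} → (∀ {c} → (k , c) ∉ τ) → (∀ {a} → (a , k) ∉ τ)
    → ∀ xs → α k (map (collapse τ) xs) ≡ α k xs
  α-collapse-unmatched {k} ¬left ¬right xs = trans (count-map (k ≟_) (collapse τ) xs)
    (count-cong ((k ≟_) ∘ collapse τ) (k ≟_) {xs} (λ {x} _ → collapse-fixes-unmatched ¬left ¬right x))

module Labelled {τ : Matching}
  (increasing : ∀ {a b} → (a , b) ∈ τ → a < b)
  (unique : Unique (endpoints τ))
  (noncrossing : ∀ {a b c d} → (a , c) ∈ τ → (b , d) ∈ τ → ¬ (a < b × b < c × c < d))
  (u : ℕ → ℕ)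
  (two⇒left : ∀ k → u k ≡ 2 → ∃ λ c → (k , c) ∈ τ)
  (right⇒zero : ∀ {a k} → (a , k) ∈ τ → u k ≡ 0)
  where

  open Arcs increasing unique

  leftsAt rightsAt : ℕ → ℕ
  leftsAt k = count ((k ≟_) ∘ proj₁) τ
  rightsAt k = count ((k ≟_) ∘ proj₂) τ

  leftsWithin rightsWithin : ℕ → ℕ → ℕ
  leftsWithin a m = count (within? a m ∘ proj₁) τ
  rightsWithin a m = count (within? a m ∘ proj₂) τ

  endsWithin-suc : ∀ (f : ℕ × ℕ → ℕ) {a m} → a ≤ m
    → count (within? a (suc m) ∘ f) τ ≡ count (within? a m ∘ f) τ + count ((suc m ≟_) ∘ f) τ
  endsWithin-suc f {a} {m} a≤m = trans
    (count-cong (within? a (suc m) ∘ f) (λ e → within? a m (f e) ⊎-dec (suc m ≟ f e)) {τ}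
                (λ {e} _ → Within-suc a≤m (f e)))
    (count-⊎ (within? a m ∘ f) ((suc m ≟_) ∘ f) τ
             (λ (_ , fe≤m) 1+m≡fe → <-irrefl (sym 1+m≡fe) (s≤s fe≤m)))

  endsWithin-empty : ∀ (f : ℕ × ℕ → ℕ) a → count (within? a a ∘ f) τ ≡ 0
  endsWithin-empty f a =
    count-≡0 (within? a a ∘ f) {τ} λ _ (a<fe , fe≤a) → <-irrefl refl (<-≤-trans a<fe fe≤a)

  noneEndAt : ∀ {k} → u k ≢ 0 → rightsAt k ≡ 0
  noneEndAt {k} u≢0 =
    count-≡0 ((k ≟_) ∘ proj₂) λ { {_ , _} a,k∈τ refl → u≢0 (right⇒zero a,k∈τ) }

  local-balance : ∀ k → indicator (u k ≟ 2) + rightsAt k ≤ indicator (u k ≟ 0) + leftsAt k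
  local-balance k with u k ≟ 2 | u k ≟ 0
  ... | yes u≡2 | _ = begin
    1 + rightsAt k  ≡⟨ cong suc (noneEndAt (λ u≡0 → contradiction (trans (sym u≡2) u≡0) λ ())) ⟩
    1               ≤⟨ ∈⇒count-pos ((k ≟_) ∘ proj₁) (proj₂ (two⇒left k u≡2)) refl ⟩
    leftsAt k       ≤⟨ m≤n+m _ _ ⟩
    _ + leftsAt k   ∎
    where open ≤-Reasoning
  ... | no _ | yes _ = ≤-trans (rightsAt≤1 unique k) (m≤m+n 1 _)
  ... | no _ | no u≢0 = ≤-trans (≤-reflexive (noneEndAt u≢0)) z≤n

  prefix-balance : ∀ {a m} → a ≤′ m
    → labelCount u 2 a m + rightsWithin a m ≤ labelCount u 0 a m + leftsWithin a m
  prefix-balance {a} ≤′-refl =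
    ≤-trans (≤-reflexive (cong₂ _+_ (labelCount-empty u 2 a) (endsWithin-empty proj₂ a))) z≤n
  prefix-balance {a} (≤′-step {m} a≤′m) = begin
    labelCount u 2 a (suc m) + rightsWithin a (suc m)
      ≡⟨ cong₂ _+_ (labelCount-suc u 2 a≤m) (endsWithin-suc proj₂ a≤m) ⟩
    (labelCount u 2 a m + indicator (u (suc m) ≟ 2)) + (rightsWithin a m + rightsAt (suc m))
      ≡⟨ interchange +-commutativeSemigroup (labelCount u 2 a m) _ (rightsWithin a m) _ ⟩
    (labelCount u 2 a m + rightsWithin a m) + (indicator (u (suc m) ≟ 2) + rightsAt (suc m))
      ≤⟨ +-mono-≤ (prefix-balance a≤′m) (local-balance (suc m)) ⟩
    (labelCount u 0 a m + leftsWithin a m) + (indicator (u (suc m) ≟ 0) + leftsAt (suc m))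
      ≡⟨ interchange +-commutativeSemigroup (labelCount u 0 a m) (leftsWithin a m) _ _ ⟩
    (labelCount u 0 a m + indicator (u (suc m) ≟ 0)) + (leftsWithin a m + leftsAt (suc m))
      ≡⟨ cong₂ _+_ (labelCount-suc u 0 a≤m) (endsWithin-suc proj₁ a≤m) ⟨
    labelCount u 0 a (suc m) + leftsWithin a (suc m) ∎
    where
    open ≤-Reasoning
    a≤m = ≤′⇒≤ a≤′m

  arc-imbalance : ∀ {a d} → (a , d) ∈ τ → leftsWithin a d < rightsWithin a d
  arc-imbalance {a} {d} a,d∈τ =
    count-mono-< (within? a d ∘ proj₁) (within? a d ∘ proj₂) inner a,d∈τ
      (λ (a<a , _) → <-irrefl refl a<a) (increasing a,d∈τ , ≤-refl)
    where
    inner : ∀ {e} → e ∈ τ → Within a d (proj₁ e) → Within a d (proj₂ e)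
    inner {b , c} b,c∈τ (a<b , b≤d) = <-trans a<b (increasing b,c∈τ) , ≮⇒≥ crossing
      where
      crossing : ¬ d < c
      crossing d<c with m≤n⇒m<n∨m≡n b≤d
      ... | inj₁ b<d = noncrossing a,d∈τ b,c∈τ (a<b , b<d , d<c)
      ... | inj₂ refl = left≢right b,c∈τ a,d∈τ

  twos<zeros-under-arc : ∀ {a d} → (a , d) ∈ τ → labelCount u 2 a d < labelCount u 0 a d
  twos<zeros-under-arc {a} {d} a,d∈τ = +-cancelʳ-< (rightsWithin a d) _ _ (begin-strict
    labelCount u 2 a d + rightsWithin a d  ≤⟨ prefix-balance (≤⇒≤′ (<⇒≤ (increasing a,d∈τ))) ⟩
    labelCount u 0 a d + leftsWithin a d   <⟨ +-monoʳ-< _ (arc-imbalance a,d∈τ) ⟩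
    labelCount u 0 a d + rightsWithin a d  ∎)
    where open ≤-Reasoning

  nested-arcs : ∀ {A B} → A < B → u A ≡ 2 → u B ≡ 2
    → (∀ m → A ≤ m → m < B → labelCount u 0 A m ≤ labelCount u 2 A m)
    → ∃ λ c → ∃ λ d → (A , d) ∈ τ × (B , c) ∈ τ × c < d
  nested-arcs {A} {B} A<B uA≡2 uB≡2 prefix with two⇒left A uA≡2 | two⇒left B uB≡2
  ... | d , A,d∈τ | c , B,c∈τ with <-cmp d B
  ...   | tri< d<B _ _ = contradiction (prefix d (<⇒≤ (increasing A,d∈τ)) d<B)
                                       (<⇒≱ (twos<zeros-under-arc A,d∈τ))
  ...   | tri≈ _ refl _ = ⊥-elim (left≢right B,c∈τ A,d∈τ)
  ...   | tri> _ _ B<d with <-cmp c d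
  ...     | tri< c<d _ _ = c , d , A,d∈τ , B,c∈τ , c<d
  ...     | tri≈ _ refl _ = ⊥-elim (<-irrefl (same-right⇒same-left A,d∈τ B,c∈τ) A<B)
  ...     | tri> _ _ d<c = ⊥-elim (noncrossing A,d∈τ B,c∈τ (A<B , B<d , d<c))

isEven-suc : ∀ m → isEven (suc m) ≡ not (isEven m)
isEven-suc m with isEven m
... | true = refl
... | false = refl

isEven-double : ∀ j → isEven (2 * j) ≡ true
isEven-double zero = refl
isEven-double (suc j) = begin
  isEven (2 * suc j)          ≡⟨ cong isEven (*-suc 2 j) ⟩
  isEven (suc (suc (2 * j)))  ≡⟨ isEven-suc (suc (2 * j)) ⟩
  not (isEven (suc (2 * j)))  ≡⟨ cong not (isEven-suc (2 * j)) ⟩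
  not (not (isEven (2 * j)))  ≡⟨ not-involutive _ ⟩
  isEven (2 * j)              ≡⟨ isEven-double j ⟩
  true                        ∎
  where open ≡-Reasoning

υ-absent : ∀ q k → α k q ≡ 0 → υ q k ≡ 0
υ-absent q k α≡0 with α k q
... | zero = refl

υ-odd : ∀ q k → Odd (α k q) → υ q k ≡ 1
υ-odd q k odd with α k q | odd
... | .(suc (2 * j)) | j , refl rewrite isEven-suc (2 * j) | isEven-double j = refl

υ≡2⇒present : ∀ q k → υ q k ≡ 2 → α k q ≢ 0
υ≡2⇒present q k υ≡2 α≡0 with () ← trans (sym υ≡2) (υ-absent q k α≡0)

IsSign : ℤ → Set
IsSign s = s ≡ 1ℤ ⊎ s ≡ -1ℤ

sign-* : ∀ {s t} → IsSign s → IsSign t → IsSign (s ℤ.* t)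
sign-* (inj₁ refl) (inj₁ refl) = inj₁ refl
sign-* (inj₁ refl) (inj₂ refl) = inj₂ refl
sign-* (inj₂ refl) (inj₁ refl) = inj₂ refl
sign-* (inj₂ refl) (inj₂ refl) = inj₁ refl

sign≢0 : ∀ {s} → IsSign s → s ≢ 0ℤ
sign≢0 (inj₁ refl) ()
sign≢0 (inj₂ refl) ()

prodAt-sign : ∀ p σ k → All IsSign σ → IsSign (prodAt p σ k)
prodAt-sign [] _ _ _ = inj₁ refl
prodAt-sign (_ ∷ _) [] _ _ = inj₁ refl
prodAt-sign (x ∷ p) (s ∷ σ) k (s± ∷ σ±) with k ≟ x
... | yes _ = sign-* s± (prodAt-sign p σ k σ±)
... | no _ = prodAt-sign p σ k σ±

σbar-sign : ∀ p σ k → All IsSign σ → α k p ≢ 0 → IsSign (σbar p σ k)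
σbar-sign p σ k σ± α≢0 with α k p
... | zero = contradiction refl α≢0
... | suc _ = prodAt-sign p σ k σ±

σbar′-absent : ∀ p σ τ k → α k (p′ τ p) ≡ 0 → σbar′ p σ τ k ≡ 0ℤ
σbar′-absent p σ τ k α≡0 with α k (p′ τ p)
... | zero = refl

σbar′-present : ∀ p σ τ k → α k (p′ τ p) ≢ 0 → σbar′ p σ τ k ≡ σbar p σ k
σbar′-present p σ τ k α≢0 with α k (p′ τ p)
... | zero = contradiction refl α≢0
... | suc _ = refl

α-sort : ∀ k xs → α k (sort xs) ≡ α k xs
α-sort k xs = count-↭ (k ≟_) (sort-↭ xs)

α≢0⇒∈ : ∀ {k xs} → α k xs ≢ 0 → k ∈ xs
α≢0⇒∈ {k} {xs} α≢0 with count-pos⇒∈ (k ≟_) xs (n≢0⇒n>0 α≢0)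
... | _ , x∈xs , refl = x∈xs

∈⇒α≢0 : ∀ {k xs} → k ∈ xs → α k xs ≢ 0
∈⇒α≢0 {k} k∈xs = n>0⇒n≢0 (∈⇒count-pos (k ≟_) k∈xs refl)

module Collapsed {p : List ℕ} {τ : Matching} (isNC : IsNCMatching p τ) where

  increasing : ∀ {a b} → (a , b) ∈ τ → a < b
  increasing a,b∈τ = proj₁ (proj₁ isNC a,b∈τ)

  unique : Unique (endpoints τ)
  unique = proj₁ (proj₂ isNC)

  open Arcs increasing unique

  q : List ℕ
  q = sort (p′ τ p)

  α-q : ∀ k → α k q ≡ α k (map (collapse τ) p)
  α-q k = trans (α-sort k (p′ τ p)) (cong (α k) (p′≡map-collapse τ p))

  collapse-∈ : ∀ {x} → x ∈ p → collapse τ x ∈ p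
  collapse-∈ {x} x∈p with collapse-cases τ x
  ... | inj₁ (a , a,x∈τ , refl) = proj₁ (proj₂ (proj₁ isNC a,x∈τ))
  ... | inj₂ (_ , eq) = subst (_∈ p) (sym eq) x∈p

  p′-support : ∀ {k} → α k (p′ τ p) ≢ 0 → α k p ≢ 0
  p′-support α≢0 with ∈-map⁻ (collapse τ) (subst (_ ∈_) (p′≡map-collapse τ p) (α≢0⇒∈ α≢0))
  ... | x , x∈p , refl = ∈⇒α≢0 (collapse-∈ x∈p)

  isPf-q : ∀ {n} → IsPf n p → IsPf n q
  isPf-q isPf@(_ , pos , _) = subst (IsPf _ ∘ sort) (sym (p′≡map-collapse τ p))
    (isPf-sort-map (collapse τ) isPf (All.lookup pos ∘ collapse-∈) (λ {x} _ → collapse-≤ x))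

  υ-right : ∀ {a k} → (a , k) ∈ τ → υ q k ≡ 0
  υ-right {k = k} a,k∈τ = υ-absent q k (trans (α-q k) (α-collapse-right a,k∈τ p))

  α-q-unmatched : ∀ {k} → ¬ (∃ λ c → (k , c) ∈ τ) → (∀ {a} → (a , k) ∉ τ) → α k q ≡ α k p
  α-q-unmatched {k} ¬left ¬right =
    trans (α-q k) (α-collapse-unmatched (λ k,c∈τ → ¬left (_ , k,c∈τ)) ¬right p)

  υ≡2⇒left : OddShape p → ∀ k → υ q k ≡ 2 → ∃ λ c → (k , c) ∈ τ
  υ≡2⇒left oddShape k υ≡2 with leftEndpoint? τ k | collapse-cases τ k
  ... | yes left | _ = left
  ... | no _ | inj₁ (_ , a,k∈τ , _) with () ← trans (sym υ≡2) (υ-right a,k∈τ)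
  ... | no ¬left | inj₂ (¬right , _) with oddShape k
  ...   | inj₁ α≡0 with () ← trans (sym υ≡2) (υ-absent q k (trans (α-q-unmatched ¬left ¬right) α≡0))
  ...   | inj₂ odd with () ← trans (sym υ≡2) (υ-odd q k (subst Odd (sym (α-q-unmatched ¬left ¬right)) odd))

  σbar′≡σbar : ∀ {σ k} → υ q k ≡ 2 → σbar′ p σ τ k ≡ σbar p σ k
  σbar′≡σbar {σ} {k} υ≡2 =
    σbar′-present p σ τ k (υ≡2⇒present q k υ≡2 ∘ trans (α-sort k (p′ τ p)))

  module _ {σ : List ℤ} (signs : All IsSign σ) where

    σbar′-trichotomy : ∀ k
      → σbar′ p σ τ k ≡ -1ℤ ⊎ σbar′ p σ τ k ≡ 0ℤ ⊎ σbar′ p σ τ k ≡ 1ℤ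
    σbar′-trichotomy k with α k (p′ τ p) ≟ 0
    ... | yes α≡0 = inj₂ (inj₁ (σbar′-absent p σ τ k α≡0))
    ... | no α≢0 with σbar-sign p σ k signs (p′-support α≢0)
    ...   | inj₁ ≡1 = inj₂ (inj₂ (trans (σbar′-present p σ τ k α≢0) ≡1))
    ...   | inj₂ ≡-1 = inj₁ (trans (σbar′-present p σ τ k α≢0) ≡-1)

    σbar′≡0⇔absent : ∀ k → σbar′ p σ τ k ≡ 0ℤ ⇔ α k q ≡ 0
    σbar′≡0⇔absent k = mk⇔ to (σbar′-absent p σ τ k ∘ trans (sym (α-sort k (p′ τ p))))
      where
      to : σbar′ p σ τ k ≡ 0ℤ → α k q ≡ 0
      to σ′≡0 with α k (p′ τ p) ≟ 0
      ... | yes α≡0 = trans (α-sort k (p′ τ p)) α≡0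
      ... | no α≢0 = contradiction (trans (sym (σbar′-present p σ τ k α≢0)) σ′≡0)
                                   (sign≢0 (σbar-sign p σ k signs (p′-support α≢0)))

proposition3p13 : (n : ℕ) (p : List ℕ) (σ : List ℤ) (τ : Matching)
    → IsOShPf n p σ τ
    → IsGarage n (φo-q p σ τ) (φo-ρ n p σ τ)
proposition3p13 n p σ τ
  (isPf , oddShape , (_ , signs) , isNC@(_ , _ , noncrossing) , _ , _ , nested⇒sameSign) =
  ( (isPf-q isPf , sort-↗ (p′ τ p) , σbar′-trichotomy signs ∘ val , σbar′≡0⇔absent signs ∘ val)
  , garage )
  where
  open Collapsed isNC
  open Labelled increasing unique noncrossing (υ q) (υ≡2⇒left oddShape) υ-right

  garage : ∀ (i j : Fin n) → toℕ i < toℕ j → υ q (val i) ≡ 2 → υ q (val j) ≡ 2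
    → (∀ m → val i ≤ m → m < val j → countυ q 0 (val i) m ≤ countυ q 2 (val i) m)
    → φo-ρ n p σ τ i ≡ φo-ρ n p σ τ j
  garage i j i<j υi≡2 υj≡2 prefix with nested-arcs (s≤s i<j) υi≡2 υj≡2 prefix
  ... | c , d , i,d∈τ , j,c∈τ , c<d = begin
    σbar′ p σ τ (val i)  ≡⟨ σbar′≡σbar υi≡2 ⟩
    σbar p σ (val i)     ≡⟨ nested⇒sameSign i,d∈τ j,c∈τ (s≤s i<j) (increasing j,c∈τ) c<d ⟩
    σbar p σ (val j)     ≡⟨ σbar′≡σbar υj≡2 ⟨
    σbar′ p σ τ (val j)  ∎
    where open ≡-Reasoning
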